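{- For every base $\mathcal{B}$, atomic multisets $L,K$, finite multiset $\Gamma=\{\gamma_1,\dots,\gamma_k\}$ of formulae and formula $\psi$: if $\Vdash^{L}_{\mathcal{B}}\,!\Gamma$ and $!\Gamma\Vdash^{K}_{\mathcal{B}}\psi$, then $\Vdash^{L\uplus K}_{\mathcal{B}}\psi$, where $!\Gamma=\{!\gamma_1,\dots,!\gamma_k\}$.
   Context: Fix a set $\mathbb{A}$ of propositional atoms. All multisets are finite; $\uplus$ denotes multiset union; an atomic multiset is a finite multiset of atoms. Formulae: $\varphi ::= p\in\mathbb{A}\mid\top\mid 0\mid 1\mid\varphi\multimap\varphi\mid\varphi\otimes\varphi\mid\varphi\mathbin{\&}\varphi\mid\varphi\oplus\varphi\mid\,!\varphi$. Bases. An atomic sequent is a pair $P\Rightarrow p$ ($P$ atomic multiset, $p$ atom); an atomic box is a finite multiset of atomic sequents; an atomic rule is a triple $\langle\mathbf{A},\mathbf{S},p\rangle$ with $\mathbf{A}$ a finite multiset of atomic boxes, $\mathbf{S}$ an atomic box, $p$ an atom. A base is a set of atomic rules; $\mathcal{C}\supseteq\mathcal{B}$ is set inclusion. An atom $p$ is persistent in $\mathcal{B}$ if $\mathcal{B}$ contains a rule $\langle\varnothing,\mathbf{S},p\rangle$ with $\mathbf{S}\neq\varnothing$. Derivability $P\vdash_{\mathcal{B}}p$ is the smallest relation closed under: (Ref) $\{p\}\vdash_{\mathcal{B}}p$; (App) if $\langle\mathbf{A},\mathbf{S},p\rangle\in\mathcal{B}$ with $\mathbf{A}=\{\mathbf{T}_1,\dots,\mathbf{T}_m\}$,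 and there are $n\ge m$, atomic multisets $C_1,\dots,C_n$ and a multiset $D=\{d_{m+1},\dots,d_n\}$ of atoms persistent in $\mathcal{B}$ with $C_i\uplus Q\vdash_{\mathcal{B}}q$ for all $i\le m$ and $Q\Rightarrow q\in\mathbf{T}_i$, $C_j\vdash_{\mathcal{B}}d_j$ for all $m<j\le n$, and $D\uplus U\vdash_{\mathcal{B}}v$ for all $U\Rightarrow v\in\mathbf{S}$, then $C_1\uplus\dots\uplus C_n\vdash_{\mathcal{B}}p$. Support. For a base $\mathcal{B}$, atomic multiset $L$: (At) $\Vdash^L_{\mathcal{B}}p$ iff $L\vdash_{\mathcal{B}}p$; ($\multimap$) $\Vdash^L_{\mathcal{B}}\varphi\multimap\psi$ iff $\varphi\Vdash^L_{\mathcal{B}}\psi$; ($\otimes$) $\Vdash^L_{\mathcal{B}}\varphi\otimes\psi$ iff for all $\mathcal{C}\supseteq\mathcal{B}$, atomic multisets $K$, atoms $p$: if $\{\varphi,\psi\}\Vdash^K_{\mathcal{C}}p$ then $\Vdash^{L\uplus K}_{\mathcal{C}}p$; ($1$) $\Vdash^L_{\mathcal{B}}1$ iff for all $\mathcal{C}\supseteq\mathcal{B}$, $K$, $p$: if $\Vdash^K_{\mathcal{C}}p$ then $\Vdash^{L\uplus K}_{\mathcal{C}}p$; ($\mathbin{\&}$) $\Vdash^L_{\mathcal{B}}\varphi\mathbin{\&}\psi$ iff $\Vdash^L_{\mathcal{B}}\varphi$ and $\Vdash^L_{\mathcal{B}}\psi$; ($\oplus$) $\Vdash^L_{\mathcal{B}}\varphi\oplus\psi$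 iff for all $\mathcal{C}\supseteq\mathcal{B}$, $K$, $p$: if $\varphi\Vdash^K_{\mathcal{C}}p$ and $\psi\Vdash^K_{\mathcal{C}}p$ then $\Vdash^{L\uplus K}_{\mathcal{C}}p$; ($0$) $\Vdash^L_{\mathcal{B}}0$ iff $\Vdash^{L\uplus K}_{\mathcal{B}}p$ for all atoms $p$ and atomic multisets $K$; ($\top$) $\Vdash^L_{\mathcal{B}}\top$ always; ($!$) $\Vdash^L_{\mathcal{B}}\,!\varphi$ iff for all $\mathcal{C}\supseteq\mathcal{B}$, $K$, $p$: if (for all $\mathcal{D}\supseteq\mathcal{C}$, $\Vdash^{\varnothing}_{\mathcal{D}}\varphi$ implies $\Vdash^K_{\mathcal{D}}p$) then $\Vdash^{L\uplus K}_{\mathcal{C}}p$. Multisets: $\Vdash^L_{\mathcal{B}}\varnothing$ iff $L=\varnothing$; $\Vdash^L_{\mathcal{B}}\{\varphi\}$ iff $\Vdash^L_{\mathcal{B}}\varphi$; $\Vdash^L_{\mathcal{B}}\Gamma\uplus\Delta$ iff $L=K\uplus M$ for some $K,M$ with $\Vdash^K_{\mathcal{B}}\Gamma$, $\Vdash^M_{\mathcal{B}}\Delta$. (Inf) For non-empty $\Gamma$, write $\Gamma=\,!\Delta\uplus\Theta$ with $!\Delta$ the elements whose top-level connective is $!$ and $\Theta$ the rest; $\Gamma\Vdash^L_{\mathcal{B}}\varphi$ iff for all $\mathcal{C}\supseteq\mathcal{B}$ and atomic $K$: if $\Vdash^{\varnothing}_{\mathcal{C}}\delta$ for every $\delta\in\Delta$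 and $\Vdash^K_{\mathcal{C}}\Theta$, then $\Vdash^{L\uplus K}_{\mathcal{C}}\varphi$. For $\Gamma=\varnothing$, $\Gamma\Vdash^L_{\mathcal{B}}\varphi$ means $\Vdash^L_{\mathcal{B}}\varphi$. -}

-- Base-extension semantics for intuitionistic linear logic.
-- Multisets are represented by lists; multiset equality is list
-- permutation (_↭_), multiset union is _++_.
module Defs where

open import Level using (Level; Lift; lift; _⊔_) renaming (suc to lsuc; zero to lzero)
open import Data.List using (List; []; _∷_; _++_; map; concat)
open import Data.List.Relation.Unary.All using (All)
open import Data.List.Relation.Binary.Pointwise using (Pointwise)
open import Data.List.Relation.Binary.Permutation.Propositional using (_↭_)
open import Data.Product using (Σ; Σ-syntax; _×_; _,_; proj₁; proj₂)
open import Data.Unit.Polymorphic using (⊤)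
open import Relation.Binary.PropositionalEquality using (_≡_; _≢_)

module _ (Atom : Set) where

  AMS : Set
  AMS = List Atom

  record Sequent : Set where
    constructor _⇒_
    field
      ante : AMS
      succ : Atom
  open Sequent public

  Box : Set
  Box = List Sequent

  record Rule : Set where
    constructor ⟨_,_,_⟩
    field
      premises : List Box
      discharge : Box
      concl : Atom
  open Rule public

  Base : Set₁
  Base = Rule → Set

  _⊆_ : Base → Base → Set
  B ⊆ C = ∀ r → B r → C r

  Persistent : Base → Atom → Set
  Persistent B p = Σ[ r ∈ Rule ] (B r × premises r ≡ [] × discharge r ≢ [] × concl r ≡ p)

  data Derives (B : Base) : AMS → Atom → Set where
    ref : ∀ {P p} → P ↭ (p ∷ []) → Derives B P p
    -- (App): Cs = C₁ … C_m (one per premise box T_i),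
    --        Es = (C_{m+1}, d_{m+1}) … (C_n, d_n), D = {d_{m+1}, …, d_n}
    app : ∀ {P} (r : Rule) → B r →
          (Cs : List AMS) →
          Pointwise (λ C T → All (λ s → Derives B (C ++ ante s) (succ s)) T) Cs (premises r) →
          (Es : List (AMS × Atom)) →
          All (λ e → Persistent B (proj₂ e)) Es →
          All (λ e → Derives B (proj₁ e) (proj₂ e)) Es →
          All (λ s → Derives B (map proj₂ Es ++ ante s) (succ s)) (discharge r) →
          P ↭ (concat Cs ++ concat (map proj₁ Es)) →
          Derives B P (concl r)

  infixr 5 _⊸_
  infixr 6 _⊗_ _&_ _⊕_
  data Formula : Set where
    atom : Atom → Formula
    𝟙⊤ : Formula          -- ⊤
    𝟘 : Formula
    𝟙 : Formula
    _⊸_ _⊗_ _&_ _⊕_ : Formula → Formula → Formula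
    ! : Formula → Formula

  -- To keep the recursion structural, a member of a
  -- (non-empty) context is handed to the generic (Inf) clause as an
  -- "element": either a !-formula !δ, given by the predicate
  -- "C ↦ ⊩^∅_C δ", or a non-! formula θ, given by "C, K ↦ ⊩^K_C θ".

  data Elem : Set₂ where
    bang  : (Base → Set₁) → Elem
    plain : (Base → AMS → Set₁) → Elem

  bangs : List Elem → List (Base → Set₁)
  bangs [] = []
  bangs (bang P ∷ es) = P ∷ bangs es
  bangs (plain _ ∷ es) = bangs es

  plains : List Elem → List (Base → AMS → Set₁)
  plains [] = []
  plains (bang _ ∷ es) = plains es
  plains (plain P ∷ es) = P ∷ plains es

  SuppMS : List (AMS → Set₁) → AMS → Set₁
  SuppMS [] L = Lift _ (L ≡ [])
  SuppMS (P ∷ []) L = P L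
  SuppMS (P ∷ Q ∷ Ps) L = Σ[ K ∈ AMS ] Σ[ M ∈ AMS ] (L ↭ (K ++ M) × P K × SuppMS (Q ∷ Ps) M)

  AllBang : List (Base → Set₁) → Base → Set₁
  AllBang [] C = ⊤
  AllBang (P ∷ Ps) C = P C × AllBang Ps C

  -- (Inf) for a non-empty context Γ = !Δ ⊎ Θ, with goal predicate G:
  -- for all C ⊇ B and K, if ⊩^∅_C δ for δ ∈ Δ and ⊩^K_C Θ then G C (L ⊎ K).
  InfG : List Elem → Base → AMS → (Base → AMS → Set₁) → Set₁
  InfG es B L G = ∀ (C : Base) → B ⊆ C → ∀ (K : AMS) →
    AllBang (bangs es) C →
    SuppMS (map (λ P → P C) (plains es)) K →
    G C (L ++ K)

  mutual
    Supp : Base → AMS → Formula → Set₁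
    Supp B L (atom p) = Lift _ (Derives B L p)
    Supp B L (φ ⊸ ψ) = InfG (elem φ ∷ []) B L (λ C M → Supp C M ψ)
    Supp B L (φ ⊗ ψ) = ∀ (C : Base) → B ⊆ C → ∀ (K : AMS) (p : Atom) →
      InfG (elem φ ∷ elem ψ ∷ []) C K (λ D M → Lift _ (Derives D M p)) →
      Derives C (L ++ K) p
    Supp B L 𝟙 = ∀ (C : Base) → B ⊆ C → ∀ (K : AMS) (p : Atom) →
      Derives C K p → Derives C (L ++ K) p
    Supp B L (φ & ψ) = Supp B L φ × Supp B L ψ
    Supp B L (φ ⊕ ψ) = ∀ (C : Base) → B ⊆ C → ∀ (K : AMS) (p : Atom) →
      InfG (elem φ ∷ []) C K (λ D M → Lift _ (Derives D M p)) →
      InfG (elem ψ ∷ []) C K (λ D M → Lift _ (Derives D M p)) →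
      Derives C (L ++ K) p
    Supp B L 𝟘 = ∀ (p : Atom) (K : AMS) → Lift _ (Derives B (L ++ K) p)
    Supp B L 𝟙⊤ = ⊤
    Supp B L (! φ) = ∀ (C : Base) → B ⊆ C → ∀ (K : AMS) (p : Atom) →
      (∀ (D : Base) → C ⊆ D → Supp D [] φ → Derives D K p) →
      Derives C (L ++ K) p

    elem : Formula → Elem
    elem (! δ) = bang (λ C → Supp C [] δ)
    elem φ = plain (λ C M → Supp C M φ)

  SuppCtx : Base → AMS → List Formula → Set₁
  SuppCtx B L Γ = SuppMS (map (λ φ M → Supp B M φ) Γ) L

  Inf : List Formula → Base → AMS → Formula → Set₁
  Inf [] B L φ = Supp B L φ
  Inf (γ ∷ Γ) B L φ = InfG (map elem (γ ∷ Γ)) B L (λ C M → Supp C M φ)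

  !ₘ : List Formula → List Formula
  !ₘ = map !

module Submission where

-- Support of !γ says: whatever atom follows from K in every extension in
-- which γ is supported (with no resources) already follows from L ⊎ K.
-- Abstracting "γ is supported" to an arbitrary predicate P on bases gives a
-- notion closed under pairing of predicates, so ⊩^L !Γ yields it for the
-- predicate "all γ ∈ Γ are supported".  Such an L can then be plugged into
-- any ψ that is supported by K wherever P holds; this is proved by induction
-- on ψ, the atomic case being the definition itself and every other case
-- reducing to an atomic goal in an extended base.  Finally !Γ ⊩^K ψ is
-- precisely "ψ is supported by K wherever all γ ∈ Γ are supported".

open import Defs
open import Data.List using (List; []; _∷_; _++_; map)
open import Data.List.Properties using (++-assoc; ++-identityʳ)
open import Data.List.Relation.Unary.All using (All; []; _∷_)
open import Data.List.Relation.Binary.Pointwise using (Pointwise; []; _∷_)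
open import Data.List.Relation.Binary.Permutation.Propositional using (_↭_; ↭-trans; ↭-reflexive)
open import Data.List.Relation.Binary.Permutation.Propositional.Properties using (++⁺ʳ)
open import Data.Product using (_×_; _,_; proj₁; proj₂)
open import Data.Unit.Polymorphic using (tt)
open import Level using (lift; lower)
open import Relation.Binary.PropositionalEquality using (_≡_; refl; subst; sym)

module _ {Atom : Set} where

  ⊆-refl : {B : Base Atom} → _⊆_ Atom B B
  ⊆-refl r x = x

  ⊆-trans : {B C D : Base Atom} → _⊆_ Atom B C → _⊆_ Atom C D → _⊆_ Atom B D
  ⊆-trans s t r x = t r (s r x)

  Persistent-mono : ∀ {B C} → _⊆_ Atom B C → ∀ {p} → Persistent Atom B p → Persistent Atom C p
  Persistent-mono s (r , Br , no-premises , nonempty , concl≡p) = r , s r Br , no-premises , nonempty , concl≡p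

  mutual
    Derives-mono : ∀ {B C P p} → _⊆_ Atom B C → Derives Atom B P p → Derives Atom C P p
    Derives-mono s (ref P↭p) = ref P↭p
    Derives-mono s (app r Br Cs premises Es persistent derived discharged P↭) =
      app r (s r Br) Cs (premises-mono s premises) Es (allPersistent-mono s persistent)
        (derived-mono s derived) (box-mono s discharged) P↭

    premises-mono : ∀ {B C} → _⊆_ Atom B C → ∀ {Cs Ts} →
      Pointwise (λ X T → All (λ q → Derives Atom B (X ++ ante q) (succ q)) T) Cs Ts →
      Pointwise (λ X T → All (λ q → Derives Atom C (X ++ ante q) (succ q)) T) Cs Ts
    premises-mono s [] = []
    premises-mono s (box ∷ boxes) = box-mono s box ∷ premises-mono s boxes

    box-mono : ∀ {B C} → _⊆_ Atom B C → ∀ {X T} →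
      All (λ q → Derives Atom B (X ++ ante q) (succ q)) T →
      All (λ q → Derives Atom C (X ++ ante q) (succ q)) T
    box-mono s [] = []
    box-mono s (d ∷ ds) = Derives-mono s d ∷ box-mono s ds

    derived-mono : ∀ {B C} → _⊆_ Atom B C → ∀ {Es : List (AMS Atom × Atom)} →
      All (λ e → Derives Atom B (proj₁ e) (proj₂ e)) Es →
      All (λ e → Derives Atom C (proj₁ e) (proj₂ e)) Es
    derived-mono s [] = []
    derived-mono s (d ∷ ds) = Derives-mono s d ∷ derived-mono s ds

    allPersistent-mono : ∀ {B C} → _⊆_ Atom B C → ∀ {Es : List (AMS Atom × Atom)} →
      All (λ e → Persistent Atom B (proj₂ e)) Es →
      All (λ e → Persistent Atom C (proj₂ e)) Es
    allPersistent-mono s [] = []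
    allPersistent-mono s (q ∷ qs) = Persistent-mono s q ∷ allPersistent-mono s qs

  Derives-resp-↭ : ∀ {B P Q p} → P ↭ Q → Derives Atom B Q p → Derives Atom B P p
  Derives-resp-↭ P↭Q (ref Q↭p) = ref (↭-trans P↭Q Q↭p)
  Derives-resp-↭ P↭Q (app r Br Cs premises Es persistent derived discharged Q↭) =
    app r Br Cs premises Es persistent derived discharged (↭-trans P↭Q Q↭)

  Derives-reassoc : ∀ {B p} L K M → Derives Atom B (L ++ (K ++ M)) p → Derives Atom B ((L ++ K) ++ M) p
  Derives-reassoc L K M = Derives-resp-↭ (↭-reflexive (++-assoc L K M))

  Supp-mono : ∀ {B C L} (φ : Formula Atom) → _⊆_ Atom B C → Supp Atom B L φ → Supp Atom C L φ
  Supp-mono (atom p) s (lift d) = lift (Derives-mono s d)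
  Supp-mono 𝟙⊤ s h = tt
  Supp-mono 𝟘 s h p K = lift (Derives-mono s (lower (h p K)))
  Supp-mono 𝟙 s h C t = h C (⊆-trans s t)
  Supp-mono (φ ⊸ ψ) s h C t = h C (⊆-trans s t)
  Supp-mono (φ ⊗ ψ) s h C t = h C (⊆-trans s t)
  Supp-mono (φ & ψ) s (hφ , hψ) = Supp-mono φ s hφ , Supp-mono ψ s hψ
  Supp-mono (φ ⊕ ψ) s h C t = h C (⊆-trans s t)
  Supp-mono (! φ) s h C t = h C (⊆-trans s t)

  elem-mono : (φ : Formula Atom) → ∀ {C D M} → _⊆_ Atom C D →
    AllBang Atom (bangs Atom (elem Atom φ ∷ [])) C →
    SuppMS Atom (map (λ P → P C) (plains Atom (elem Atom φ ∷ []))) M →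
    AllBang Atom (bangs Atom (elem Atom φ ∷ [])) D ×
    SuppMS Atom (map (λ P → P D) (plains Atom (elem Atom φ ∷ []))) M
  elem-mono (atom p) s a m = a , Supp-mono (atom p) s m
  elem-mono 𝟙⊤ s a m = a , tt
  elem-mono 𝟘 s a m = a , Supp-mono 𝟘 s m
  elem-mono 𝟙 s a m = a , Supp-mono 𝟙 s m
  elem-mono (φ ⊸ ψ) s a m = a , Supp-mono (φ ⊸ ψ) s m
  elem-mono (φ ⊗ ψ) s a m = a , Supp-mono (φ ⊗ ψ) s m
  elem-mono (φ & ψ) s a m = a , Supp-mono (φ & ψ) s m
  elem-mono (φ ⊕ ψ) s a m = a , Supp-mono (φ ⊕ ψ) s m
  elem-mono (! φ) s (a , tt) m = (Supp-mono φ s a , tt) , m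

  -- Supp B L (! φ) is by definition BangSupp B L (λ D → Supp D [] φ).
  BangSupp : Base Atom → AMS Atom → (Base Atom → Set₁) → Set₁
  BangSupp B L P = ∀ C → _⊆_ Atom B C → ∀ K p →
    (∀ D → _⊆_ Atom C D → P D → Derives Atom D K p) → Derives Atom C (L ++ K) p

  BangSupp-mono : ∀ {B C L P} → _⊆_ Atom B C → BangSupp B L P → BangSupp C L P
  BangSupp-mono s h D t = h D (⊆-trans s t)

  BangSupp-× : ∀ {B L M P Q} → (∀ C D → _⊆_ Atom C D → P C → P D) →
    BangSupp B L P → BangSupp B M Q → BangSupp B (L ++ M) (λ D → P D × Q D)
  BangSupp-× {L = L} {M} P-mono hP hQ C s K p f =
    Derives-reassoc L M K
      (hP C s (M ++ K) p (λ D t pD → hQ D (⊆-trans s t) K p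
         (λ E u qE → f E (⊆-trans t u) (P-mono D E u pD , qE))))

  BangSupp-elim : ∀ (ψ : Formula Atom) {B L K P} → BangSupp B L P →
    (∀ C → _⊆_ Atom B C → P C → Supp Atom C K ψ) → Supp Atom B (L ++ K) ψ
  BangSupp-elim (atom p) h g = lift (h _ ⊆-refl _ p (λ D t pD → lower (g D t pD)))
  BangSupp-elim 𝟙⊤ h g = tt
  BangSupp-elim 𝟘 {L = L} {K} h g p K′ = lift (Derives-reassoc L K K′
    (h _ ⊆-refl (K ++ K′) p (λ D t pD → lower (g D t pD p K′))))
  BangSupp-elim 𝟙 {L = L} {K} h g C s K′ p d = Derives-reassoc L K K′
    (h C s (K ++ K′) p (λ D t pD → g D (⊆-trans s t) pD D ⊆-refl K′ p (Derives-mono t d)))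
  BangSupp-elim (φ ⊗ ψ) {L = L} {K} h g C s K′ p d = Derives-reassoc L K K′
    (h C s (K ++ K′) p (λ D t pD → g D (⊆-trans s t) pD D ⊆-refl K′ p (λ E u → d E (⊆-trans t u))))
  BangSupp-elim (φ ⊕ ψ) {L = L} {K} h g C s K′ p dφ dψ = Derives-reassoc L K K′
    (h C s (K ++ K′) p (λ D t pD → g D (⊆-trans s t) pD D ⊆-refl K′ p
       (λ E u → dφ E (⊆-trans t u)) (λ E u → dψ E (⊆-trans t u))))
  BangSupp-elim (! φ) {L = L} {K} h g C s K′ p d = Derives-reassoc L K K′
    (h C s (K ++ K′) p (λ D t pD → g D (⊆-trans s t) pD D ⊆-refl K′ p (λ E u → d E (⊆-trans t u))))
  BangSupp-elim (φ & ψ) h g =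
    BangSupp-elim φ h (λ C s pC → proj₁ (g C s pC)) , BangSupp-elim ψ h (λ C s pC → proj₂ (g C s pC))
  BangSupp-elim (φ ⊸ ψ) {L = L} {K} h g C s M a m =
    subst (λ X → Supp Atom C X ψ) (sym (++-assoc L K M))
      (BangSupp-elim ψ (BangSupp-mono s h) (λ D t pD →
         let (a′ , m′) = elem-mono φ t a m in g D (⊆-trans s t) pD D ⊆-refl M a′ m′))

  AllSupp : List (Formula Atom) → Base Atom → Set₁
  AllSupp Γ = AllBang Atom (bangs Atom (map (elem Atom) (!ₘ Atom Γ)))

  SuppCtx-!ₘ⇒BangSupp : ∀ {B L} (Γ : List (Formula Atom)) →
    SuppCtx Atom B L (!ₘ Atom Γ) → BangSupp B L (AllSupp Γ)
  SuppCtx-!ₘ⇒BangSupp [] (lift refl) C s K p f = f C ⊆-refl tt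
  SuppCtx-!ₘ⇒BangSupp (γ ∷ []) h C s K p f = h C s K p (λ D t hγ → f D t (hγ , tt))
  SuppCtx-!ₘ⇒BangSupp (γ ∷ γ′ ∷ Γ) (L₁ , L₂ , L↭ , hγ , hΓ) C s K p f =
    Derives-resp-↭ (++⁺ʳ K L↭)
      (BangSupp-× (λ C D t → Supp-mono γ t) hγ (SuppCtx-!ₘ⇒BangSupp (γ′ ∷ Γ) hΓ) C s K p f)

  plains-!ₘ : (Γ : List (Formula Atom)) → plains Atom (map (elem Atom) (!ₘ Atom Γ)) ≡ []
  plains-!ₘ [] = refl
  plains-!ₘ (γ ∷ Γ) = plains-!ₘ Γ

  Inf-!ₘ⇒Supp : ∀ {B K ψ} (γ : Formula Atom) (Γ : List (Formula Atom)) →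
    Inf Atom (!ₘ Atom (γ ∷ Γ)) B K ψ →
    ∀ C → _⊆_ Atom B C → AllSupp (γ ∷ Γ) C → Supp Atom C K ψ
  Inf-!ₘ⇒Supp {K = K} {ψ} γ Γ inf C s all =
    subst (λ X → Supp Atom C X ψ) (++-identityʳ K) (inf C s [] all no-plain-resources)
    where
    no-plain-resources : SuppMS Atom (map (λ P → P C) (plains Atom (map (elem Atom) (!ₘ Atom (γ ∷ Γ))))) []
    no-plain-resources rewrite plains-!ₘ (γ ∷ Γ) = lift refl

mainTheorem17 : (Atom : Set) (B : Base Atom) (L K : List Atom) (Γ : List (Formula Atom)) (ψ : Formula Atom) →
    SuppCtx Atom B L (!ₘ Atom Γ) → Inf Atom (!ₘ Atom Γ) B K ψ → Supp Atom B (L ++ K) ψ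
mainTheorem17 Atom B .[] K [] ψ (lift refl) inf = inf
mainTheorem17 Atom B L K (γ ∷ Γ) ψ supp inf =
  BangSupp-elim ψ (SuppCtx-!ₘ⇒BangSupp (γ ∷ Γ) supp) (Inf-!ₘ⇒Supp γ Γ inf)
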